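{- Let $L$ be a residuated lattice and $n\geq 1$ an integer. Every $n$-fold positive implicative filter of $L$ is an $(n+1)$-fold positive implicative filter of $L$.
   Context: A residuated lattice is an algebra $(L,\wedge,\vee,\otimes,\rightarrow,0,1)$ such that $(L,\wedge,\vee,0,1)$ is a bounded lattice, $(L,\otimes,1)$ is a commutative monoid, and $x\otimes y\leq z$ iff $x\leq y\rightarrow z$. For $x\in L$ and $k\geq 1$, $x^k=x\otimes\cdots\otimes x$ ($k$ factors). For $k\geq1$, a subset $F\subseteq L$ is a $k$-fold positive implicative filter if $1\in F$ and for all $x,y,z\in L$: $x\rightarrow((y^k\rightarrow z)\rightarrow y)\in F$ and $x\in F$ imply $y\in F$. -}

module Defs where

open import Level using (Level; _⊔_; suc)
open import Data.Nat using (ℕ; zero) renaming (suc to sucℕ)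
open import Data.Product using (_×_)
open import Relation.Binary.Core using (Rel)
open import Relation.Binary.PropositionalEquality using (_≡_)
open import Relation.Unary using (Pred; _∈_)
open import Algebra.Core using (Op₂)
open import Algebra.Structures using (IsCommutativeMonoid)
open import Algebra.Lattice.Structures using (IsLattice)

record ResiduatedLattice (c : Level) : Set (suc c) where
  infixr 6 _⊗_
  infixr 5 _⇒_
  infixr 7 _∧_
  infixr 6 _∨_
  infix 4 _≈_ _≤_
  field
    Carrier : Set c

  _≈_ : Rel Carrier c
  _≈_ = _≡_

  field
    _∧_     : Op₂ Carrier
    _∨_     : Op₂ Carrier
    _⊗_     : Op₂ Carrier
    _⇒_     : Op₂ Carrier
    𝟎       : Carrier
    𝟏       : Carrier
    isLattice : IsLattice _≈_ _∨_ _∧_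

  _≤_ : Rel Carrier c
  x ≤ y = (x ∧ y) ≈ x

  field
    𝟎-least    : ∀ x → 𝟎 ≤ x
    𝟏-greatest : ∀ x → x ≤ 𝟏
    ⊗-isCommutativeMonoid : IsCommutativeMonoid _≈_ _⊗_ 𝟏
    residuation-⇒ : ∀ x y z → x ⊗ y ≤ z → x ≤ y ⇒ z
    residuation-⇐ : ∀ x y z → x ≤ y ⇒ z → x ⊗ y ≤ z

  -- x ^ k = x ⊗ ⋯ ⊗ x (k factors), for k ≥ 1; we set x ^ 0 = 1 (unused).
  _^_ : Carrier → ℕ → Carrier
  x ^ zero = 𝟏
  x ^ sucℕ zero = x
  x ^ sucℕ (sucℕ k) = x ⊗ (x ^ sucℕ k)

  IsKFoldPIFilter : ∀ {p} → ℕ → Pred Carrier p → Set (c ⊔ p)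
  IsKFoldPIFilter k F =
    (𝟏 ∈ F) ×
    (∀ x y z → (x ⇒ ((y ^ k) ⇒ z) ⇒ y) ∈ F → x ∈ F → y ∈ F)

module Submission where

-- In a residuated lattice implication is "curried":
-- (a ⊗ b) ⇒ z = b ⇒ (a ⇒ z).  Since y^(n+1) = y ⊗ y^n for n ≥ 1, this gives
--   y^(n+1) ⇒ z = y^n ⇒ (y ⇒ z),
-- so every instance  x ⇒ ((y^(n+1) ⇒ z) ⇒ y)  of the (n+1)-fold condition is
-- literally an instance of the n-fold condition, with z replaced by y ⇒ z.

open import Defs
open import Data.Nat using (ℕ; _≤_; suc; s≤s)
open import Data.Product using (_,_; ∃)
open import Relation.Unary using (Pred; _∈_)
open import Relation.Binary.PropositionalEquality
  using (_≡_; sym; trans; cong; subst)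
open import Algebra.Lattice.Structures using (IsLattice)
open import Algebra.Structures using (IsCommutativeMonoid)

module ResiduatedLatticeProperties {c} (L : ResiduatedLattice c) where
  open ResiduatedLattice L renaming (_≤_ to _≼_)
  open IsLattice isLattice using (∧-comm; ∨-absorbs-∧; ∧-absorbs-∨)
  open IsCommutativeMonoid ⊗-isCommutativeMonoid using (assoc; comm)

  -- The lattice order x ≼ y (defined as x ∧ y = x) is reflexive: idempotence
  -- of ∧ follows from the two absorption laws.
  ≼-refl : ∀ x → x ≼ x
  ≼-refl x = trans (cong (x ∧_) (sym (∨-absorbs-∧ x x))) (∧-absorbs-∨ x (x ∧ x))

  ≼-antisym : ∀ {x y} → x ≼ y → y ≼ x → x ≡ y
  ≼-antisym {x} {y} x≼y y≼x = trans (sym x≼y) (trans (∧-comm x y) y≼x)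

  ≡-by-lower-bounds : ∀ {u v} → (∀ w → w ≼ u → w ≼ v) → (∀ w → w ≼ v → w ≼ u) → u ≡ v
  ≡-by-lower-bounds {u} {v} u⊆v v⊆u = ≼-antisym (u⊆v u (≼-refl u)) (v⊆u v (≼-refl v))

  ⊗-shuffle : ∀ w a b → (w ⊗ b) ⊗ a ≡ w ⊗ (a ⊗ b)
  ⊗-shuffle w a b = trans (assoc w b a) (cong (w ⊗_) (comm b a))

  -- Currying: implication from a product is iterated implication.  Both sides
  -- have the same lower bounds w, namely those with w ⊗ (a ⊗ b) ≼ z.
  ⇒-curry : ∀ a b z → (a ⊗ b) ⇒ z ≡ b ⇒ (a ⇒ z)
  ⇒-curry a b z = ≡-by-lower-bounds curry uncurry
    where
    curry : ∀ w → w ≼ (a ⊗ b) ⇒ z → w ≼ b ⇒ (a ⇒ z)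
    curry w w≼ = residuation-⇒ w b (a ⇒ z) (residuation-⇒ (w ⊗ b) a z
      (subst (_≼ z) (sym (⊗-shuffle w a b)) (residuation-⇐ w (a ⊗ b) z w≼)))

    uncurry : ∀ w → w ≼ b ⇒ (a ⇒ z) → w ≼ (a ⊗ b) ⇒ z
    uncurry w w≼ = residuation-⇒ w (a ⊗ b) z
      (subst (_≼ z) (⊗-shuffle w a b)
        (residuation-⇐ (w ⊗ b) a z (residuation-⇐ w b (a ⇒ z) w≼)))

  -- For k ≥ 1 we have y^(k+1) = y ⊗ y^k, so an implication from y^(k+1)
  -- peels off one factor y.
  ⇒-power-suc : ∀ y z k → 1 ≤ k → (y ^ suc k) ⇒ z ≡ (y ^ k) ⇒ (y ⇒ z)
  ⇒-power-suc y z (suc m) (s≤s _) = ⇒-curry y (y ^ suc m) z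

  kFold-transfer : ∀ {p} k k′ (F : Pred Carrier p) →
    (∀ y z → ∃ λ z′ → (y ^ k′) ⇒ z ≡ (y ^ k) ⇒ z′) →
    IsKFoldPIFilter k F → IsKFoldPIFilter k′ F
  kFold-transfer k k′ F rewrite-power (𝟏∈F , k-fold) = 𝟏∈F , k′-fold
    where
    k′-fold : ∀ x y z → (x ⇒ ((y ^ k′) ⇒ z) ⇒ y) ∈ F → x ∈ F → y ∈ F
    k′-fold x y z premise x∈F with rewrite-power y z
    ... | z′ , eq = k-fold x y z′ (subst F (cong (λ t → x ⇒ t ⇒ y) eq) premise) x∈F

open ResiduatedLatticeProperties

proposition5p9 : ∀ {c p} (L : ResiduatedLattice c) (n : ℕ) → 1 ≤ n →
    (F : Pred (ResiduatedLattice.Carrier L) p) →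
    ResiduatedLattice.IsKFoldPIFilter L n F →
    ResiduatedLattice.IsKFoldPIFilter L (suc n) F
proposition5p9 L n 1≤n F = kFold-transfer L n (suc n) F peel
  where
  open ResiduatedLattice L using (_⇒_; _^_)

  peel : ∀ y z → ∃ λ z′ → (y ^ suc n) ⇒ z ≡ (y ^ n) ⇒ z′
  peel y z = y ⇒ z , ⇒-power-suc L y z n 1≤n
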